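{- For every integer $n\ge 1$, let $\mathcal{A}_n=\{1,3,\dots,2n-1\}\cup\{2n+2,2n+4,\dots,4n\}$ and $\mathcal{B}_n=\{2,4,\dots,2n\}\cup\{2n+1,2n+3,\dots,4n-1\}$, and for a set $\mathcal{S}=\{s_1<s_2<\dots<s_{2n}\}$ of integers put $\Delta(\mathcal{S})=\prod_{1\le i<j\le 2n}(s_j-s_i)$. Then \[\frac{\Delta(\mathcal{A}_n)}{\Delta(\mathcal{B}_n)}=\prod_{1\le i,j\le n}\frac{2n+1+2j-2i}{2n-1+2j-2i}.\] -}

module Defs where

open import Data.Nat as ℕ using (ℕ; zero; suc)
open import Data.Integer as ℤ using (ℤ; +_; _-_; ∣_∣)
open import Data.Rational as ℚ using (ℚ; _/_)
open import Data.List using (List; []; _∷_; map; upTo; foldr; _++_; concatMap)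

prodℚ : List ℚ → ℚ
prodℚ = foldr ℚ._*_ ℚ.1ℚ

prodℤ : List ℤ → ℤ
prodℤ = foldr ℤ._*_ (+ 1)

-- total division of integers into ℚ (the denominator is always nonzero
-- where it is used; the value at 0 is an irrelevant convention)
_÷ℤ_ : ℤ → ℤ → ℚ
p ÷ℤ (+ zero)      = ℚ.0ℚ
p ÷ℤ q@(+ suc _)   = p / ∣ q ∣
p ÷ℤ q@(ℤ.-[1+ _ ]) = ℤ.- p / ∣ q ∣

-- Δ(S) = ∏_{i<j} (s_j - s_i) for S listed as s_1 < s_2 < ... (increasing)
Δ : List ℤ → ℤ
Δ []       = + 1
Δ (s ∷ ss) = prodℤ (map (λ t → t - s) ss) ℤ.* Δ ss

𝒜 : ℕ → List ℤ
𝒜 n = map (λ k → + (2 ℕ.* k ℕ.+ 1)) (upTo n)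
   ++ map (λ k → + (2 ℕ.* n ℕ.+ 2 ℕ.+ 2 ℕ.* k)) (upTo n)

ℬ : ℕ → List ℤ
ℬ n = map (λ k → + (2 ℕ.* k ℕ.+ 2)) (upTo n)
   ++ map (λ k → + (2 ℕ.* n ℕ.+ 1 ℕ.+ 2 ℕ.* k)) (upTo n)

range1 : ℕ → List ℕ
range1 n = map suc (upTo n)

rhs : ℕ → ℚ
rhs n = prodℚ (concatMap (λ i → map (λ j →
          (+ (2 ℕ.* n ℕ.+ 1 ℕ.+ 2 ℕ.* j) - + (2 ℕ.* i))
          ÷ℤ (+ (2 ℕ.* n ℕ.+ 2 ℕ.* j) - + 1 - + (2 ℕ.* i)))
          (range1 n)) (range1 n))

-- Splitting each set into its two arithmetic progressions X < Y,
-- Δ(X ∪ Y) = Δ(X) Δ(Y) ∏_{x∈X, y∈Y} (y − x). The progressions of ℬ_n are those of 𝒜_n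
-- shifted by ±1 and Δ is translation invariant, so the four within-progression factors cancel
-- (they are positive). What remains are the two cross products, and after reindexing
-- i, j ↦ i − 1, j − 1 they are the numerator and denominator of the right-hand side.
module Submission where

open import Defs
open import Algebra.Core using (Op₂)
open import Algebra.Structures using (IsMonoid)
open import Data.Nat as ℕ using (ℕ; zero; suc; _≥_)
import Data.Nat.Properties as ℕ
open import Data.Nat.Tactic.RingSolver as ℕ-Solver using ()
open import Data.Integer as ℤ using (ℤ; +_; +[1+_]; -[1+_]; _-_; Positive; positive)
import Data.Integer.Properties as ℤ
open import Data.Integer.Tactic.RingSolver as ℤ-Solver using ()
open import Data.Rational as ℚ using (ℚ; _/_)
import Data.Rational.Properties as ℚ
import Data.Rational.Unnormalised as ℚᵘ
import Data.Rational.Unnormalised.Properties as ℚᵘ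
open import Data.List using (List; []; _∷_; map; upTo; foldr; _++_; concatMap)
open import Data.List.Properties using (map-++; map-∘; map-cong; concatMap-map; concatMap-cong)
open import Data.List.Relation.Unary.All as All using (All; []; _∷_)
import Data.List.Relation.Unary.All.Properties as All
open import Data.List.Relation.Unary.AllPairs as AllPairs using (AllPairs; []; _∷_)
import Data.List.Relation.Unary.AllPairs.Properties as AllPairs
open import Function using (_∘_)
open import Relation.Binary.PropositionalEquality

private variable A B : Set

module _ {M : Set} {_∙_ : Op₂ M} {ε : M} (isMonoid : IsMonoid _≡_ _∙_ ε) where
  open IsMonoid isMonoid using (assoc; identityˡ)

  foldr-++-homo : ∀ xs ys → foldr _∙_ ε (xs ++ ys) ≡ foldr _∙_ ε xs ∙ foldr _∙_ ε ys
  foldr-++-homo []       ys = sym (identityˡ _)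
  foldr-++-homo (x ∷ xs) ys = trans (cong (x ∙_) (foldr-++-homo xs ys)) (sym (assoc x _ _))

  foldr-concatMap : ∀ (f : A → List M) xs →
                    foldr _∙_ ε (concatMap f xs) ≡ foldr _∙_ ε (map (foldr _∙_ ε ∘ f) xs)
  foldr-concatMap f []       = refl
  foldr-concatMap f (x ∷ xs) =
    trans (foldr-++-homo (f x) (concatMap f xs)) (cong (_ ∙_) (foldr-concatMap f xs))

prodℤ-++ : ∀ xs ys → prodℤ (xs ++ ys) ≡ prodℤ xs ℤ.* prodℤ ys
prodℤ-++ = foldr-++-homo ℤ.*-1-isMonoid

prodℤ-concatMap : ∀ (f : A → List ℤ) xs → prodℤ (concatMap f xs) ≡ prodℤ (map (prodℤ ∘ f) xs)
prodℤ-concatMap = foldr-concatMap ℤ.*-1-isMonoid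

prodℚ-concatMap : ∀ (f : A → List ℚ) xs → prodℚ (concatMap f xs) ≡ prodℚ (map (prodℚ ∘ f) xs)
prodℚ-concatMap = foldr-concatMap ℚ.*-1-isMonoid

concatMap-map-map : ∀ {A B C D E : Set} (F : C → D → E) (f : A → C) (g : B → D) xs ys →
  concatMap (λ x → map (F x) (map g ys)) (map f xs)
  ≡ concatMap (λ i → map (λ j → F (f i) (g j)) ys) xs
concatMap-map-map F f g xs ys =
  trans (concatMap-map _ f xs) (concatMap-cong (λ i → sym (map-∘ ys)) xs)

fromℚᵘ-homo-* : ∀ p q → ℚ.fromℚᵘ p ℚ.* ℚ.fromℚᵘ q ≡ ℚ.fromℚᵘ (p ℚᵘ.* q)
fromℚᵘ-homo-* p q = ℚ.toℚᵘ-injective (begin-equality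
  ℚ.toℚᵘ (ℚ.fromℚᵘ p ℚ.* ℚ.fromℚᵘ q)          ≃⟨ ℚ.toℚᵘ-homo-* (ℚ.fromℚᵘ p) (ℚ.fromℚᵘ q) ⟩
  ℚ.toℚᵘ (ℚ.fromℚᵘ p) ℚᵘ.* ℚ.toℚᵘ (ℚ.fromℚᵘ q) ≃⟨ ℚᵘ.*-cong (ℚ.toℚᵘ-fromℚᵘ p) (ℚ.toℚᵘ-fromℚᵘ q) ⟩
  p ℚᵘ.* q                                    ≃⟨ ℚ.toℚᵘ-fromℚᵘ (p ℚᵘ.* q) ⟨
  ℚ.toℚᵘ (ℚ.fromℚᵘ (p ℚᵘ.* q))                ∎)
  where open ℚᵘ.≤-Reasoning

/-*-/ : ∀ a m c k → (a / suc m) ℚ.* (c / suc k) ≡ (a ℤ.* c) / (suc m ℕ.* suc k)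
/-*-/ a m c k = fromℚᵘ-homo-* (ℚᵘ.mkℚᵘ a m) (ℚᵘ.mkℚᵘ c k)

÷ℤ-*-÷ℤ : ∀ a b c d → (a ÷ℤ b) ℚ.* (c ÷ℤ d) ≡ (a ℤ.* c) ÷ℤ (b ℤ.* d)
÷ℤ-*-÷ℤ a (+ zero)   c d          = ℚ.*-zeroˡ (c ÷ℤ d)
÷ℤ-*-÷ℤ a b          c (+ zero)   rewrite ℤ.*-zeroʳ b = ℚ.*-zeroʳ (a ÷ℤ b)
÷ℤ-*-÷ℤ a +[1+ m ]   c +[1+ k ]   = /-*-/ a m c k
÷ℤ-*-÷ℤ a +[1+ m ]   c -[1+ k ]   =
  trans (/-*-/ a m (ℤ.- c) k) (cong (_/ _) (sym (ℤ.neg-distribʳ-* a c)))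
÷ℤ-*-÷ℤ a -[1+ m ]   c +[1+ k ]   =
  trans (/-*-/ (ℤ.- a) m c k) (cong (_/ _) (sym (ℤ.neg-distribˡ-* a c)))
÷ℤ-*-÷ℤ a -[1+ m ]   c -[1+ k ]   =
  trans (/-*-/ (ℤ.- a) m (ℤ.- c) k) (cong (_/ _) (-a*-c≡a*c a c))
  where
  -a*-c≡a*c : ∀ a c → ℤ.- a ℤ.* ℤ.- c ≡ a ℤ.* c
  -a*-c≡a*c = ℤ-Solver.solve-∀

÷ℤ-self : ∀ c .{{_ : Positive c}} → c ÷ℤ c ≡ ℚ.1ℚ
÷ℤ-self +[1+ m ] = ℚ.toℚᵘ-injective
  (ℚᵘ.≃-trans (ℚ.toℚᵘ-fromℚᵘ (ℚᵘ.mkℚᵘ +[1+ m ] m)) (ℚᵘ.*≡* (ℤ.*-comm +[1+ m ] (+ 1))))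

÷ℤ-cancelˡ : ∀ c a b .{{_ : Positive c}} → (c ℤ.* a) ÷ℤ (c ℤ.* b) ≡ a ÷ℤ b
÷ℤ-cancelˡ c a b = begin
  (c ℤ.* a) ÷ℤ (c ℤ.* b)   ≡⟨ ÷ℤ-*-÷ℤ c c a b ⟨
  (c ÷ℤ c) ℚ.* (a ÷ℤ b)    ≡⟨ cong (ℚ._* (a ÷ℤ b)) (÷ℤ-self c) ⟩
  ℚ.1ℚ ℚ.* (a ÷ℤ b)        ≡⟨ ℚ.*-identityˡ (a ÷ℤ b) ⟩
  a ÷ℤ b                   ∎
  where open ≡-Reasoning

÷ℤ-cancelʳ : ∀ c a b .{{_ : Positive c}} → (a ℤ.* c) ÷ℤ (b ℤ.* c) ≡ a ÷ℤ b
÷ℤ-cancelʳ c a b = trans (cong₂ _÷ℤ_ (ℤ.*-comm a c) (ℤ.*-comm b c)) (÷ℤ-cancelˡ c a b)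

prodℚ-map-÷ℤ : ∀ (f g : A → ℤ) xs →
  prodℚ (map (λ x → f x ÷ℤ g x) xs) ≡ prodℤ (map f xs) ÷ℤ prodℤ (map g xs)
prodℚ-map-÷ℤ f g []       = refl
prodℚ-map-÷ℤ f g (x ∷ xs) =
  trans (cong (f x ÷ℤ g x ℚ.*_) (prodℚ-map-÷ℤ f g xs)) (÷ℤ-*-÷ℤ (f x) (g x) _ _)

prodℚ-concatMap-÷ℤ : ∀ (f g : A → B → ℤ) xs ys →
  prodℚ (concatMap (λ x → map (λ y → f x y ÷ℤ g x y) ys) xs)
  ≡ prodℤ (concatMap (λ x → map (f x) ys) xs) ÷ℤ prodℤ (concatMap (λ x → map (g x) ys) xs)
prodℚ-concatMap-÷ℤ f g xs ys = begin
  prodℚ (concatMap (λ x → map (λ y → f x y ÷ℤ g x y) ys) xs)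
    ≡⟨ prodℚ-concatMap _ xs ⟩
  prodℚ (map (λ x → prodℚ (map (λ y → f x y ÷ℤ g x y) ys)) xs)
    ≡⟨ cong prodℚ (map-cong (λ x → prodℚ-map-÷ℤ (f x) (g x) ys) xs) ⟩
  prodℚ (map (λ x → prodℤ (map (f x) ys) ÷ℤ prodℤ (map (g x) ys)) xs)
    ≡⟨ prodℚ-map-÷ℤ _ _ xs ⟩
  prodℤ (map (λ x → prodℤ (map (f x) ys)) xs) ÷ℤ prodℤ (map (λ x → prodℤ (map (g x) ys)) xs)
    ≡⟨ cong₂ _÷ℤ_ (prodℤ-concatMap _ xs) (prodℤ-concatMap _ xs) ⟨
  prodℤ (concatMap (λ x → map (f x) ys) xs) ÷ℤ prodℤ (concatMap (λ x → map (g x) ys) xs)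
    ∎
  where open ≡-Reasoning

cross : List ℤ → List ℤ → ℤ
cross xs ys = prodℤ (concatMap (λ x → map (λ y → y - x) ys) xs)

cross-map-map : ∀ (f : A → ℤ) (g : B → ℤ) xs ys →
  cross (map f xs) (map g ys) ≡ prodℤ (concatMap (λ i → map (λ j → g j - f i) ys) xs)
cross-map-map f g xs ys = cong prodℤ (concatMap-map-map (λ x y → y - x) f g xs ys)

Δ-++ : ∀ xs ys → Δ (xs ++ ys) ≡ Δ xs ℤ.* (cross xs ys ℤ.* Δ ys)
Δ-++ []       ys = sym (trans (ℤ.*-identityˡ _) (ℤ.*-identityˡ _))
Δ-++ (x ∷ xs) ys = begin
  prodℤ (map (_- x) (xs ++ ys)) ℤ.* Δ (xs ++ ys)
    ≡⟨ cong₂ ℤ._*_ (trans (cong prodℤ (map-++ (_- x) xs ys)) (prodℤ-++ (map (_- x) xs) _))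
                   (Δ-++ xs ys) ⟩
  (P ℤ.* Q) ℤ.* (Δ xs ℤ.* (cross xs ys ℤ.* Δ ys))
    ≡⟨ regroup P Q (Δ xs) (cross xs ys) (Δ ys) ⟩
  (P ℤ.* Δ xs) ℤ.* ((Q ℤ.* cross xs ys) ℤ.* Δ ys)
    ≡⟨ cong (λ z → (P ℤ.* Δ xs) ℤ.* (z ℤ.* Δ ys)) (prodℤ-++ (map (_- x) ys) _) ⟨
  Δ (x ∷ xs) ℤ.* (cross (x ∷ xs) ys ℤ.* Δ ys)
    ∎
  where
  open ≡-Reasoning
  P = prodℤ (map (_- x) xs)
  Q = prodℤ (map (_- x) ys)
  regroup : ∀ p q a c b → (p ℤ.* q) ℤ.* (a ℤ.* (c ℤ.* b)) ≡ (p ℤ.* a) ℤ.* ((q ℤ.* c) ℤ.* b)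
  regroup = ℤ-Solver.solve-∀

Δ-translation : ∀ c xs → Δ (map (ℤ._+ c) xs) ≡ Δ xs
Δ-translation c []       = refl
Δ-translation c (x ∷ xs) = cong₂ ℤ._*_
  (cong prodℤ (trans (sym (map-∘ xs)) (map-cong (λ t → shift-diff t x c) xs)))
  (Δ-translation c xs)
  where
  shift-diff : ∀ t x c → (t ℤ.+ c) - (x ℤ.+ c) ≡ t - x
  shift-diff = ℤ-Solver.solve-∀

Δ-map-translation : ∀ (f g : A → ℤ) c → (∀ x → g x ≡ f x ℤ.+ c) → ∀ xs → Δ (map g xs) ≡ Δ (map f xs)
Δ-map-translation f g c g≗f+c xs =
  trans (cong Δ (trans (map-cong g≗f+c xs) (map-∘ xs))) (Δ-translation c (map f xs))

pos*pos⇒pos : ∀ i j .{{_ : Positive i}} .{{_ : Positive j}} → Positive (i ℤ.* j)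
pos*pos⇒pos +[1+ m ] +[1+ n ] = _

prodℤ-pos : ∀ {xs} → All Positive xs → Positive (prodℤ xs)
prodℤ-pos []           = _
prodℤ-pos (x>0 ∷ xs>0) = pos*pos⇒pos _ _ {{x>0}} {{prodℤ-pos xs>0}}

i<j⇒pos[j-i] : ∀ {i j} → i ℤ.< j → Positive (j - i)
i<j⇒pos[j-i] {i} {j} i<j = positive (subst (ℤ._< j - i) (ℤ.+-inverseʳ i) (ℤ.+-monoˡ-< (ℤ.- i) i<j))

Δ-pos : ∀ {xs} → AllPairs ℤ._<_ xs → Positive (Δ xs)
Δ-pos []           = _
Δ-pos (x<xs ∷ xs↑) =
  pos*pos⇒pos _ _ {{prodℤ-pos (All.map⁺ (All.map i<j⇒pos[j-i] x<xs))}} {{Δ-pos xs↑}}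

Δ-map-upTo-pos : ∀ (f : ℕ → ℤ) → (∀ {i j} → i ℕ.< j → f i ℤ.< f j) →
                 ∀ n → Positive (Δ (map f (upTo n)))
Δ-map-upTo-pos f f↑ n = Δ-pos (AllPairs.map⁺ (AllPairs.applyUpTo⁺₁ _ n (λ i<j _ → f↑ i<j)))

odds evens upperOdds upperEvens : ℕ → List ℤ
odds       n = map (λ k → + (2 ℕ.* k ℕ.+ 1)) (upTo n)
evens      n = map (λ k → + (2 ℕ.* k ℕ.+ 2)) (upTo n)
upperOdds  n = map (λ k → + (2 ℕ.* n ℕ.+ 1 ℕ.+ 2 ℕ.* k)) (upTo n)
upperEvens n = map (λ k → + (2 ℕ.* n ℕ.+ 2 ℕ.+ 2 ℕ.* k)) (upTo n)

Δ-evens : ∀ n → Δ (evens n) ≡ Δ (odds n)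
Δ-evens n = Δ-map-translation _ _ (+ 1) (λ k → cong +_ (2k+2≡2k+1+1 k)) (upTo n)
  where
  2k+2≡2k+1+1 : ∀ k → 2 ℕ.* k ℕ.+ 2 ≡ 2 ℕ.* k ℕ.+ 1 ℕ.+ 1
  2k+2≡2k+1+1 = ℕ-Solver.solve-∀

Δ-upperEvens : ∀ n → Δ (upperEvens n) ≡ Δ (upperOdds n)
Δ-upperEvens n = Δ-map-translation _ _ (+ 1) (λ k → cong +_ (2n+2+2k≡2n+1+2k+1 n k)) (upTo n)
  where
  2n+2+2k≡2n+1+2k+1 : ∀ n k → 2 ℕ.* n ℕ.+ 2 ℕ.+ 2 ℕ.* k ≡ 2 ℕ.* n ℕ.+ 1 ℕ.+ 2 ℕ.* k ℕ.+ 1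
  2n+2+2k≡2n+1+2k+1 = ℕ-Solver.solve-∀

prodℤ-range1²≡cross : ∀ (F : ℕ → ℕ → ℤ) (f g : ℕ → ℤ) → (∀ i j → F (suc i) (suc j) ≡ g j - f i) →
  ∀ n → prodℤ (concatMap (λ i → map (F i) (range1 n)) (range1 n))
        ≡ cross (map f (upTo n)) (map g (upTo n))
prodℤ-range1²≡cross F f g F≗g-f n = begin
  prodℤ (concatMap (λ i → map (F i) (map suc (upTo n))) (map suc (upTo n)))
    ≡⟨ cong prodℤ (concatMap-map-map F suc suc (upTo n) (upTo n)) ⟩
  prodℤ (concatMap (λ i → map (λ j → F (suc i) (suc j)) (upTo n)) (upTo n))
    ≡⟨ cong prodℤ (concatMap-cong (λ i → map-cong (F≗g-f i) (upTo n)) (upTo n)) ⟩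
  prodℤ (concatMap (λ i → map (λ j → g j - f i) (upTo n)) (upTo n))
    ≡⟨ cross-map-map f g (upTo n) (upTo n) ⟨
  cross (map f (upTo n)) (map g (upTo n))
    ∎
  where open ≡-Reasoning

[+1+m]-[+1+n]≡[+m]-[+n] : ∀ m n → + suc m - + suc n ≡ + m - + n
[+1+m]-[+1+n]≡[+m]-[+n] m n = begin
  + suc m - + suc n  ≡⟨ ℤ.[+m]-[+n]≡m⊖n (suc m) (suc n) ⟩
  suc m ℤ.⊖ suc n    ≡⟨ ℤ.[1+m]⊖[1+n]≡m⊖n m n ⟩
  m ℤ.⊖ n            ≡⟨ ℤ.[+m]-[+n]≡m⊖n m n ⟨
  + m - + n          ∎
  where open ≡-Reasoning

rhs≡cross : ∀ n → rhs n ≡ cross (odds n) (upperEvens n) ÷ℤ cross (evens n) (upperOdds n)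
rhs≡cross n = trans (prodℚ-concatMap-÷ℤ N D (range1 n) (range1 n))
  (cong₂ _÷ℤ_ (prodℤ-range1²≡cross N _ _ N-reindex n) (prodℤ-range1²≡cross D _ _ D-reindex n))
  where
  N D : ℕ → ℕ → ℤ
  N i j = + (2 ℕ.* n ℕ.+ 1 ℕ.+ 2 ℕ.* j) - + (2 ℕ.* i)
  D i j = (+ (2 ℕ.* n ℕ.+ 2 ℕ.* j) - + 1) - + (2 ℕ.* i)

  N-reindex : ∀ i j → N (suc i) (suc j) ≡ + (2 ℕ.* n ℕ.+ 2 ℕ.+ 2 ℕ.* j) - + (2 ℕ.* i ℕ.+ 1)
  N-reindex i j = trans (cong₂ (λ a b → + a - + b) (2n+1+2[1+j]≡1+[2n+2+2j] n j) (2[1+i]≡1+[2i+1] i))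
                        ([+1+m]-[+1+n]≡[+m]-[+n] (2 ℕ.* n ℕ.+ 2 ℕ.+ 2 ℕ.* j) (2 ℕ.* i ℕ.+ 1))
    where
    2n+1+2[1+j]≡1+[2n+2+2j] : ∀ n j → 2 ℕ.* n ℕ.+ 1 ℕ.+ 2 ℕ.* suc j ≡ suc (2 ℕ.* n ℕ.+ 2 ℕ.+ 2 ℕ.* j)
    2n+1+2[1+j]≡1+[2n+2+2j] = ℕ-Solver.solve-∀
    2[1+i]≡1+[2i+1] : ∀ i → 2 ℕ.* suc i ≡ suc (2 ℕ.* i ℕ.+ 1)
    2[1+i]≡1+[2i+1] = ℕ-Solver.solve-∀

  D-reindex : ∀ i j → D (suc i) (suc j) ≡ + (2 ℕ.* n ℕ.+ 1 ℕ.+ 2 ℕ.* j) - + (2 ℕ.* i ℕ.+ 2)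
  D-reindex i j = cong₂ _-_ (trans (cong (λ a → + a - + 1) (2n+2[1+j]≡1+[2n+1+2j] n j)) [1+a]-1≡a)
                            (cong +_ (2[1+i]≡2i+2 i))
    where
    2n+2[1+j]≡1+[2n+1+2j] : ∀ n j → 2 ℕ.* n ℕ.+ 2 ℕ.* suc j ≡ suc (2 ℕ.* n ℕ.+ 1 ℕ.+ 2 ℕ.* j)
    2n+2[1+j]≡1+[2n+1+2j] = ℕ-Solver.solve-∀
    2[1+i]≡2i+2 : ∀ i → 2 ℕ.* suc i ≡ 2 ℕ.* i ℕ.+ 2
    2[1+i]≡2i+2 = ℕ-Solver.solve-∀
    [1+a]-1≡a : + suc (2 ℕ.* n ℕ.+ 1 ℕ.+ 2 ℕ.* j) - + 1 ≡ + (2 ℕ.* n ℕ.+ 1 ℕ.+ 2 ℕ.* j)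
    [1+a]-1≡a = trans ([+1+m]-[+1+n]≡[+m]-[+n] _ 0) (ℤ.+-identityʳ _)

Δ𝒜÷Δℬ≡cross : ∀ n →
  Δ (𝒜 n) ÷ℤ Δ (ℬ n) ≡ cross (odds n) (upperEvens n) ÷ℤ cross (evens n) (upperOdds n)
Δ𝒜÷Δℬ≡cross n = begin
  Δ (𝒜 n) ÷ℤ Δ (ℬ n)
    ≡⟨ cong₂ _÷ℤ_ (Δ-++ O E′) (Δ-++ E O′) ⟩
  (Δ O ℤ.* (X ℤ.* Δ E′)) ÷ℤ (Δ E ℤ.* (Y ℤ.* Δ O′))
    ≡⟨ cong₂ (λ u v → (Δ O ℤ.* (X ℤ.* Δ E′)) ÷ℤ (u ℤ.* (Y ℤ.* v))) (Δ-evens n) (sym (Δ-upperEvens n)) ⟩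
  (Δ O ℤ.* (X ℤ.* Δ E′)) ÷ℤ (Δ O ℤ.* (Y ℤ.* Δ E′))
    ≡⟨ ÷ℤ-cancelˡ (Δ O) _ _ {{ΔO>0}} ⟩
  (X ℤ.* Δ E′) ÷ℤ (Y ℤ.* Δ E′)
    ≡⟨ ÷ℤ-cancelʳ (Δ E′) X Y {{ΔE′>0}} ⟩
  X ÷ℤ Y
    ∎
  where
  open ≡-Reasoning
  O = odds n
  E = evens n
  O′ = upperOdds n
  E′ = upperEvens n
  X = cross O E′
  Y = cross E O′
  ΔO>0 : Positive (Δ O)
  ΔO>0 = Δ-map-upTo-pos _ (λ i<j → ℤ.+<+ (ℕ.+-monoˡ-< 1 (ℕ.*-monoʳ-< 2 i<j))) n
  ΔE′>0 : Positive (Δ E′)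
  ΔE′>0 = Δ-map-upTo-pos _ (λ i<j → ℤ.+<+ (ℕ.+-monoʳ-< (2 ℕ.* n ℕ.+ 2) (ℕ.*-monoʳ-< 2 i<j))) n

lemma6 : (n : ℕ) → n ≥ 1 → (Δ (𝒜 n) ÷ℤ Δ (ℬ n)) ≡ rhs n
lemma6 n _ = trans (Δ𝒜÷Δℬ≡cross n) (sym (rhs≡cross n))
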